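{- Let $M_1=(E_1,\mathcal{B}_1)$ and $M_2=(E_2,\mathcal{B}_2)$ be matroids with $E_1\cap E_2=\{d\}$. Suppose that $f_{M_1}$, $f_{M_2\setminus d}$, and $f_{M_2/d}$ can be represented by $(+,\times,/)$-circuits of size $s_1$, $s_2^\setminus$, and $s_2^/$, respectively. Then the basis generating polynomial $f_M$ of $M=M_1\oplus_2M_2$ can be represented by a $(+,\times,/)$-circuit of size $s_1+s_2^\setminus+s_2^/+2$.
   Context: For a matroid $N$ with bases $\mathcal{B}$, $f_N(x)=\sum_{B\in\mathcal{B}}\prod_{e\in B}x_e$. For a matroid $(E,\mathcal{B})$ and $e\in E$, the deletion $M\setminus e$ is the matroid on $E\setminus\{e\}$ with bases $\{B\in\mathcal{B}:e\notin B\}$ and the contraction $M/e$ is the matroid on $E\setminus\{e\}$ with bases $\{B\setminus\{e\}:B\in\mathcal{B},e\in B\}$. If $E_1\cap E_2=\{d\}$, the $2$-sum $M_1\oplus_2M_2$ is the matroid on $E_1\triangle E_2$ with bases $\{(B_1\cup B_2)\setminus\{d\}:B_1\in\mathcal{B}_1,B_2\in\mathcal{B}_2,\ d\in B_1\triangle B_2\}$. A $(+,\times,/)$-circuit is a directed acyclic graph of input gates (labeled by variables) and in-degree-$2$ gates computing sum, product or quotient, with no constants and a unique output gate; its size is the number of non-input gates. -}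

module Defs where

open import Data.Nat using (ℕ; zero; suc)
open import Data.Bool using (Bool; true; false; if_then_else_; _∧_; _∨_; T)
open import Data.Fin using (Fin; zero; suc)
open import Data.Fin.Subset using (Subset; _∈_; _∉_; _∪_; _─_; ⁅_⁆)
open import Data.Vec using (Vec; []; _∷_; _++_)
open import Data.List using (List; []; _∷_; map; foldr) renaming (_++_ to _++ₗ_)
open import Data.Sum using (_⊎_; inj₁; inj₂)
open import Data.Product using (Σ; ∃; _×_; _,_)
open import Data.Maybe using (Maybe; just; nothing)
open import Data.Rational using (ℚ; 0ℚ; 1ℚ; _+_; _*_; _÷_; _≟_; ≢-nonZero)
open import Relation.Nullary using (yes; no)
open import Relation.Binary.PropositionalEquality using (_≡_)

SetSystem : ℕ → Set
SetSystem n = Subset n → Bool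

record Matroid (n : ℕ) : Set where
  field
    isBase       : SetSystem n
    base-exists  : ∃ λ B → T (isBase B)
    exchange     : ∀ B₁ B₂ → T (isBase B₁) → T (isBase B₂) →
                   ∀ x → x ∈ B₁ → x ∉ B₂ →
                   ∃ λ y → y ∈ B₂ × y ∉ B₁ × T (isBase ((B₁ ─ ⁅ x ⁆) ∪ ⁅ y ⁆))
open Matroid public

allSubsets : (n : ℕ) → List (Subset n)
allSubsets zero    = [] ∷ []
allSubsets (suc n) = map (false ∷_) (allSubsets n) ++ₗ map (true ∷_) (allSubsets n)

monomial : {n : ℕ} → (Fin n → ℚ) → Subset n → ℚ
monomial x []           = 1ℚ
monomial x (false ∷ S)  = monomial (λ i → x (suc i)) S
monomial x (true ∷ S)   = x zero * monomial (λ i → x (suc i)) S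

basisPoly : {n : ℕ} → SetSystem n → (Fin n → ℚ) → ℚ
basisPoly {n} 𝓑 x =
  foldr (λ S acc → (if 𝓑 S then monomial x S else 0ℚ) + acc) 0ℚ (allSubsets n)

-- Deletion and contraction of the element d = zero of Fin (suc n).
-- Subsets of Fin (suc n) are  b ∷ S  with b saying whether d is in it.

deletion₀ : {n : ℕ} → SetSystem (suc n) → SetSystem n
deletion₀ 𝓑 S = 𝓑 (false ∷ S)

contraction₀ : {n : ℕ} → SetSystem (suc n) → SetSystem n
contraction₀ 𝓑 S = 𝓑 (true ∷ S)

-- E₁ = Fin (suc a), E₂ = Fin (suc b), d = zero in both;
-- E₁ △ E₂ = Fin (a + b), the first a elements being E₁ ∖ {d} (suc i ↦ i),
-- the last b being E₂ ∖ {d} (suc j ↦ a + j).  For B₁ = h₁ ∷ S₁, B₂ = h₂ ∷ S₂,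
-- (B₁ ∪ B₂) ∖ {d} = S₁ ++ S₂ and d ∈ B₁ △ B₂ iff h₁ ≠ h₂.
twoSum : {a b : ℕ} → SetSystem (suc a) → SetSystem (suc b) → SetSystem (a Data.Nat.+ b)
twoSum {a} 𝓑₁ 𝓑₂ S with Data.Vec.splitAt a S
... | S₁ , S₂ , _ = (𝓑₁ (true ∷ S₁) ∧ 𝓑₂ (false ∷ S₂)) ∨ (𝓑₁ (false ∷ S₁) ∧ 𝓑₂ (true ∷ S₂))

-- (+,×,/)-circuits, as straight-line programs over input variables V.
-- Gate number k may use input gates (variables, inj₁) and earlier gates
-- (inj₂ (i : Fin k)).  No constants.  Size = number of non-input gates.

data Op : Set where
  plus times quot : Op

Arg : Set → ℕ → Set
Arg V k = V ⊎ Fin k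

data Gates (V : Set) : ℕ → Set where
  []  : Gates V zero
  _▷_ : {k : ℕ} → Gates V k → Op × Arg V k × Arg V k → Gates V (suc k)

record Circuit (V : Set) (s : ℕ) : Set where
  constructor circuit
  field
    gates  : Gates V s
    output : Arg V s
open Circuit public

divℚ : ℚ → ℚ → Maybe ℚ
divℚ p q with q ≟ 0ℚ
... | yes _  = nothing
... | no q≢0 = just (_÷_ p q {{≢-nonZero q≢0}})

applyOp : Op → ℚ → ℚ → Maybe ℚ
applyOp plus  p q = just (p + q)
applyOp times p q = just (p * q)
applyOp quot  p q = divℚ p q

evalGates : {V : Set} {k : ℕ} → (V → ℚ) → Gates V k → Maybe (Fin k → ℚ)
evalGates x [] = just (λ ())
evalGates x (G ▷ (o , l , r)) with evalGates x G
... | nothing = nothing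
... | just val with applyOp o (arg l) (arg r)
  where
    arg : _ → ℚ
    arg (inj₁ v) = x v
    arg (inj₂ i) = val i
...   | nothing = nothing
...   | just w  = just (λ { zero → w ; (suc i) → val i })

evalCircuit : {V : Set} {s : ℕ} → Circuit V s → (V → ℚ) → Maybe ℚ
evalCircuit C x with evalGates x (gates C)
... | nothing = nothing
... | just val with output C
...   | inj₁ v = just (x v)
...   | inj₂ i = just (val i)

-- C represents the rational function f: C is defined at some rational point
-- (so no division is by an identically-zero rational function), and wherever
-- it is defined its value equals f.  Over the infinite field ℚ this is exactly
-- equality of the computed rational function with f.
Represents : {V : Set} {s : ℕ} → Circuit V s → ((V → ℚ) → ℚ) → Set
Represents C f =
  (∃ λ x → ∃ λ v → evalCircuit C x ≡ just v) ×
  (∀ x v → evalCircuit C x ≡ just v → v ≡ f x)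

RepresentableBySize : {V : Set} → ℕ → ((V → ℚ) → ℚ) → Set
RepresentableBySize {V} s f = Σ (Circuit V s) λ C → Represents C f

module Submission where

-- Expanding the basis polynomials along d gives f_{M₁} = A + x_d B with A = f_{M₁∖d}, B = f_{M₁/d},
-- and f_M = B C + A D with C = f_{M₂∖d}, D = f_{M₂/d}; the second identity needs that no basis of M₁
-- contains another one.  Hence f_M = f_{M₁}(C / D, x₁) · D, which is computed by the circuits for C and
-- D, one quotient gate, the circuit for f_{M₁} with x_d replaced by that quotient, and one product gate.
-- Such a circuit is defined at the all-ones point: without constants, every gate value there is positive.

open import Defs
open import Data.Bool using (Bool; true; false; if_then_else_; _∧_; _∨_; T)
open import Data.Bool.Properties using (T-∧)
open import Data.Empty using (⊥; ⊥-elim)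
open import Data.Fin using (Fin; zero; suc; _↑ˡ_; _↑ʳ_)
open import Data.Fin.Subset using (Subset)
open import Data.List using (List; []; _∷_; map; foldr) renaming (_++_ to _++ₗ_)
open import Data.Maybe using (just; nothing)
import Data.Nat as ℕ
open import Data.Nat using (ℕ; zero; suc)
open import Data.Product using (∃; ∃₂; _×_; _,_; proj₁)
open import Data.Sum using (inj₁; inj₂)
open import Data.Vec using ([]; _∷_; _++_; splitAt; here; there)
open import Data.Vec.Functional using (tail)
open import Function using (_∘_; case_of_; Equivalence)
open import Relation.Binary.PropositionalEquality

module Polynomials where

  open import Algebra using (CommutativeMonoid)
  open import Data.Rational using (ℚ; 0ℚ; _+_; _*_)
  open import Data.Rational.Properties
  open import Data.Rational.Solver using (module +-*-Solver)
  open import Algebra.Properties.CommutativeSemigroup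
    (CommutativeMonoid.commutativeSemigroup +-0-commutativeMonoid) using (interchange)

  sumMap : {A : Set} → (A → ℚ) → List A → ℚ
  sumMap g = foldr (λ S acc → g S + acc) 0ℚ

  sumMap-++ : {A : Set} (g : A → ℚ) (xs ys : List A) → sumMap g (xs ++ₗ ys) ≡ sumMap g xs + sumMap g ys
  sumMap-++ g []       ys = sym (+-identityˡ _)
  sumMap-++ g (x ∷ xs) ys = trans (cong (g x +_) (sumMap-++ g xs ys)) (sym (+-assoc (g x) _ _))

  sumMap-map : {A B : Set} (g : B → ℚ) (h : A → B) (xs : List A) → sumMap g (map h xs) ≡ sumMap (g ∘ h) xs
  sumMap-map g h []       = refl
  sumMap-map g h (x ∷ xs) = cong (g (h x) +_) (sumMap-map g h xs)

  sumMap-cong : {A : Set} {g h : A → ℚ} → g ≗ h → (xs : List A) → sumMap g xs ≡ sumMap h xs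
  sumMap-cong g≗h []       = refl
  sumMap-cong g≗h (x ∷ xs) = cong₂ _+_ (g≗h x) (sumMap-cong g≗h xs)

  sumMap-+ : {A : Set} (g h : A → ℚ) (xs : List A) →
             sumMap (λ S → g S + h S) xs ≡ sumMap g xs + sumMap h xs
  sumMap-+ g h []       = sym (+-identityˡ _)
  sumMap-+ g h (x ∷ xs) =
    trans (cong ((g x + h x) +_) (sumMap-+ g h xs)) (interchange (g x) (h x) _ _)

  sumMap-*ˡ : {A : Set} (c : ℚ) (g : A → ℚ) (xs : List A) → sumMap (λ S → c * g S) xs ≡ c * sumMap g xs
  sumMap-*ˡ c g []       = sym (*-zeroʳ c)
  sumMap-*ˡ c g (x ∷ xs) = trans (cong (c * g x +_) (sumMap-*ˡ c g xs)) (sym (*-distribˡ-+ c (g x) _))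

  sumMap-*ʳ : {A : Set} (c : ℚ) (g : A → ℚ) (xs : List A) → sumMap (λ S → g S * c) xs ≡ sumMap g xs * c
  sumMap-*ʳ c g xs =
    trans (sumMap-cong (λ S → *-comm (g S) c) xs) (trans (sumMap-*ˡ c g xs) (*-comm c _))

  subsetSum : (n : ℕ) → (Subset n → ℚ) → ℚ
  subsetSum n g = sumMap g (allSubsets n)

  subsetSum-cong : (n : ℕ) {g h : Subset n → ℚ} → g ≗ h → subsetSum n g ≡ subsetSum n h
  subsetSum-cong n g≗h = sumMap-cong g≗h (allSubsets n)

  subsetSum-bilinear : (a b : ℕ) (p r : Subset a → ℚ) (c d : Subset b → ℚ) →
    subsetSum a (λ S₁ → subsetSum b (λ S₂ → p S₁ * c S₂ + r S₁ * d S₂)) ≡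
    subsetSum a p * subsetSum b c + subsetSum a r * subsetSum b d
  subsetSum-bilinear a b p r c d = begin
    subsetSum a (λ S₁ → subsetSum b (λ S₂ → p S₁ * c S₂ + r S₁ * d S₂))
      ≡⟨ subsetSum-cong a inner ⟩
    subsetSum a (λ S₁ → p S₁ * subsetSum b c + r S₁ * subsetSum b d)
      ≡⟨ sumMap-+ (λ S₁ → p S₁ * subsetSum b c) (λ S₁ → r S₁ * subsetSum b d) (allSubsets a) ⟩
    subsetSum a (λ S₁ → p S₁ * subsetSum b c) + subsetSum a (λ S₁ → r S₁ * subsetSum b d)
      ≡⟨ cong₂ _+_ (sumMap-*ʳ _ p (allSubsets a)) (sumMap-*ʳ _ r (allSubsets a)) ⟩
    subsetSum a p * subsetSum b c + subsetSum a r * subsetSum b d ∎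
    where
    open ≡-Reasoning
    inner : (S₁ : Subset a) → subsetSum b (λ S₂ → p S₁ * c S₂ + r S₁ * d S₂) ≡
                              p S₁ * subsetSum b c + r S₁ * subsetSum b d
    inner S₁ = trans (sumMap-+ (λ S₂ → p S₁ * c S₂) (λ S₂ → r S₁ * d S₂) (allSubsets b))
                     (cong₂ _+_ (sumMap-*ˡ (p S₁) c (allSubsets b)) (sumMap-*ˡ (r S₁) d (allSubsets b)))

  subsetSum-suc : (n : ℕ) (g : Subset (suc n) → ℚ) →
                  subsetSum (suc n) g ≡ subsetSum n (g ∘ (false ∷_)) + subsetSum n (g ∘ (true ∷_))
  subsetSum-suc n g = trans (sumMap-++ g (map (false ∷_) (allSubsets n)) _)
                            (cong₂ _+_ (sumMap-map g _ (allSubsets n)) (sumMap-map g _ (allSubsets n)))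

  subsetSum-++ : (a b : ℕ) (g : Subset (a ℕ.+ b) → ℚ) →
                 subsetSum (a ℕ.+ b) g ≡ subsetSum a (λ S₁ → subsetSum b (λ S₂ → g (S₁ ++ S₂)))
  subsetSum-++ zero    b g = sym (+-identityʳ _)
  subsetSum-++ (suc a) b g = begin
    subsetSum (suc a ℕ.+ b) g
      ≡⟨ subsetSum-suc (a ℕ.+ b) g ⟩
    subsetSum (a ℕ.+ b) (g ∘ (false ∷_)) + subsetSum (a ℕ.+ b) (g ∘ (true ∷_))
      ≡⟨ cong₂ _+_ (subsetSum-++ a b (g ∘ (false ∷_))) (subsetSum-++ a b (g ∘ (true ∷_))) ⟩
    subsetSum a (λ S₁ → subsetSum b (λ S₂ → g (false ∷ S₁ ++ S₂))) +
    subsetSum a (λ S₁ → subsetSum b (λ S₂ → g (true ∷ S₁ ++ S₂)))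
      ≡⟨ sym (subsetSum-suc a (λ S₁ → subsetSum b (λ S₂ → g (S₁ ++ S₂)))) ⟩
    subsetSum (suc a) (λ S₁ → subsetSum b (λ S₂ → g (S₁ ++ S₂))) ∎
    where open ≡-Reasoning

  iverson : Bool → ℚ → ℚ
  iverson β m = if β then m else 0ℚ

  iverson-∧ : (β γ : Bool) (m n : ℚ) → iverson (β ∧ γ) (m * n) ≡ iverson β m * iverson γ n
  iverson-∧ false γ     m n = sym (*-zeroˡ (iverson γ n))
  iverson-∧ true  false m n = sym (*-zeroʳ m)
  iverson-∧ true  true  m n = refl

  iverson-∨ : (β γ : Bool) (m : ℚ) → (T β → T γ → ⊥) → iverson (β ∨ γ) m ≡ iverson β m + iverson γ m
  iverson-∨ false γ     m _        = sym (+-identityˡ _)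
  iverson-∨ true  false m _        = sym (+-identityʳ m)
  iverson-∨ true  true  m disjoint = ⊥-elim (disjoint _ _)

  monomial-cong : {n : ℕ} {x y : Fin n → ℚ} → x ≗ y → (S : Subset n) → monomial x S ≡ monomial y S
  monomial-cong x≗y []          = refl
  monomial-cong x≗y (false ∷ S) = monomial-cong (x≗y ∘ suc) S
  monomial-cong x≗y (true ∷ S)  = cong₂ _*_ (x≗y zero) (monomial-cong (x≗y ∘ suc) S)

  basisPoly-cong : {n : ℕ} (𝓑 : SetSystem n) {x y : Fin n → ℚ} → x ≗ y → basisPoly 𝓑 x ≡ basisPoly 𝓑 y
  basisPoly-cong {n} 𝓑 x≗y = subsetSum-cong n (λ S → cong (iverson (𝓑 S)) (monomial-cong x≗y S))

  monomial-++ : {a b : ℕ} (x : Fin (a ℕ.+ b) → ℚ) (S₁ : Subset a) (S₂ : Subset b) →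
    monomial x (S₁ ++ S₂) ≡ monomial (λ i → x (i ↑ˡ b)) S₁ * monomial (λ j → x (a ↑ʳ j)) S₂
  monomial-++ x []           S₂ = sym (*-identityˡ _)
  monomial-++ x (false ∷ S₁) S₂ = monomial-++ (x ∘ suc) S₁ S₂
  monomial-++ x (true ∷ S₁)  S₂ =
    trans (cong (x zero *_) (monomial-++ (x ∘ suc) S₁ S₂)) (sym (*-assoc (x zero) _ _))

  basisPoly-deletion-contraction : {n : ℕ} (𝓑 : SetSystem (suc n)) (y : Fin (suc n) → ℚ) →
    basisPoly 𝓑 y ≡ basisPoly (deletion₀ 𝓑) (tail y) + y zero * basisPoly (contraction₀ 𝓑) (tail y)
  basisPoly-deletion-contraction {n} 𝓑 y =
    trans (subsetSum-suc n (λ S → iverson (𝓑 S) (monomial y S)))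
          (cong (basisPoly (deletion₀ 𝓑) (tail y) +_)
                (trans (subsetSum-cong n (λ S → iverson-∧ true (𝓑 (true ∷ S)) (y zero) _))
                       (sumMap-*ˡ (y zero) _ (allSubsets n))))

  splitAt-++ : {a b : ℕ} (S₁ : Subset a) (S₂ : Subset b) → splitAt a (S₁ ++ S₂) ≡ (S₁ , S₂ , refl)
  splitAt-++ []      S₂ = refl
  splitAt-++ (β ∷ S₁) S₂ rewrite splitAt-++ S₁ S₂ = refl

  twoSum-++ : {a b : ℕ} (𝓑₁ : SetSystem (suc a)) (𝓑₂ : SetSystem (suc b)) (S₁ : Subset a) (S₂ : Subset b) →
    twoSum 𝓑₁ 𝓑₂ (S₁ ++ S₂) ≡
    (contraction₀ 𝓑₁ S₁ ∧ deletion₀ 𝓑₂ S₂) ∨ (deletion₀ 𝓑₁ S₁ ∧ contraction₀ 𝓑₂ S₂)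
  twoSum-++ 𝓑₁ 𝓑₂ S₁ S₂ rewrite splitAt-++ S₁ S₂ = refl

  basisPoly-twoSum : {a b : ℕ} (𝓑₁ : SetSystem (suc a)) (𝓑₂ : SetSystem (suc b)) →
    (∀ S → T (contraction₀ 𝓑₁ S) → T (deletion₀ 𝓑₁ S) → ⊥) →
    (x : Fin (a ℕ.+ b) → ℚ) → let x₁ = λ i → x (i ↑ˡ b); x₂ = λ j → x (a ↑ʳ j) in
    basisPoly (twoSum 𝓑₁ 𝓑₂) x ≡
      basisPoly (contraction₀ 𝓑₁) x₁ * basisPoly (deletion₀ 𝓑₂) x₂ +
      basisPoly (deletion₀ 𝓑₁) x₁ * basisPoly (contraction₀ 𝓑₂) x₂
  basisPoly-twoSum {a} {b} 𝓑₁ 𝓑₂ disjoint x =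
    trans (subsetSum-++ a b (λ S → iverson (twoSum 𝓑₁ 𝓑₂ S) (monomial x S)))
          (trans (subsetSum-cong a (λ S₁ → subsetSum-cong b (summand S₁)))
                 (subsetSum-bilinear a b p r c d))
    where
    p r : Subset a → ℚ
    p S₁ = iverson (contraction₀ 𝓑₁ S₁) (monomial (λ i → x (i ↑ˡ b)) S₁)
    r S₁ = iverson (deletion₀ 𝓑₁ S₁) (monomial (λ i → x (i ↑ˡ b)) S₁)
    c d : Subset b → ℚ
    c S₂ = iverson (deletion₀ 𝓑₂ S₂) (monomial (λ j → x (a ↑ʳ j)) S₂)
    d S₂ = iverson (contraction₀ 𝓑₂ S₂) (monomial (λ j → x (a ↑ʳ j)) S₂)

    summand : ∀ S₁ S₂ → iverson (twoSum 𝓑₁ 𝓑₂ (S₁ ++ S₂)) (monomial x (S₁ ++ S₂)) ≡ p S₁ * c S₂ + r S₁ * d S₂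
    summand S₁ S₂ rewrite twoSum-++ 𝓑₁ 𝓑₂ S₁ S₂ | monomial-++ x S₁ S₂ =
      trans (iverson-∨ (contraction₀ 𝓑₁ S₁ ∧ _) (deletion₀ 𝓑₁ S₁ ∧ _) _ disjoint∧)
            (cong₂ _+_ (iverson-∧ (contraction₀ 𝓑₁ S₁) (deletion₀ 𝓑₂ S₂) _ _)
                       (iverson-∧ (deletion₀ 𝓑₁ S₁) (contraction₀ 𝓑₂ S₂) _ _))
      where
      disjoint∧ : T (contraction₀ 𝓑₁ S₁ ∧ deletion₀ 𝓑₂ S₂) → T (deletion₀ 𝓑₁ S₁ ∧ contraction₀ 𝓑₂ S₂) → ⊥
      disjoint∧ p q = disjoint S₁ (proj₁ (Equivalence.to T-∧ p)) (proj₁ (Equivalence.to T-∧ q))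

  basisPoly-twoSum-substitution : {a b : ℕ} (𝓑₁ : SetSystem (suc a)) (𝓑₂ : SetSystem (suc b)) →
    (∀ S → T (contraction₀ 𝓑₁ S) → T (deletion₀ 𝓑₁ S) → ⊥) →
    (x : Fin (a ℕ.+ b) → ℚ) (y : Fin (suc a) → ℚ) → let x₂ = λ j → x (a ↑ʳ j) in
    tail y ≗ (λ i → x (i ↑ˡ b)) →
    y zero * basisPoly (contraction₀ 𝓑₂) x₂ ≡ basisPoly (deletion₀ 𝓑₂) x₂ →
    basisPoly 𝓑₁ y * basisPoly (contraction₀ 𝓑₂) x₂ ≡ basisPoly (twoSum 𝓑₁ 𝓑₂) x
  basisPoly-twoSum-substitution {a} {b} 𝓑₁ 𝓑₂ disjoint x y tail≗x₁ quotient = begin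
    basisPoly 𝓑₁ y * D
      ≡⟨ cong (_* D) (basisPoly-deletion-contraction 𝓑₁ y) ⟩
    (basisPoly (deletion₀ 𝓑₁) (tail y) + y zero * basisPoly (contraction₀ 𝓑₁) (tail y)) * D
      ≡⟨ cong₂ (λ A B → (A + y zero * B) * D) (basisPoly-cong (deletion₀ 𝓑₁) tail≗x₁)
                                                 (basisPoly-cong (contraction₀ 𝓑₁) tail≗x₁) ⟩
    (A + y zero * B) * D
      ≡⟨ solve 4 (λ A B D u → (A :+ u :* B) :* D := B :* (u :* D) :+ A :* D) refl A B D (y zero) ⟩
    B * (y zero * D) + A * D
      ≡⟨ cong (λ t → B * t + A * D) quotient ⟩
    B * C + A * D
      ≡⟨ sym (basisPoly-twoSum 𝓑₁ 𝓑₂ disjoint x) ⟩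
    basisPoly (twoSum 𝓑₁ 𝓑₂) x ∎
    where
    open ≡-Reasoning
    open +-*-Solver
    A B : ℚ
    A = basisPoly (deletion₀ 𝓑₁) (λ i → x (i ↑ˡ b))
    B = basisPoly (contraction₀ 𝓑₁) (λ i → x (i ↑ˡ b))
    C D : ℚ
    C = basisPoly (deletion₀ 𝓑₂) (λ j → x (a ↑ʳ j))
    D = basisPoly (contraction₀ 𝓑₂) (λ j → x (a ↑ʳ j))

-- A basis together with d is never a basis: exchanging d out of it would need an element outside it.
contraction₀-deletion₀-disjoint : {n : ℕ} (M : Matroid (suc n)) (S : Subset n) →
  T (contraction₀ (isBase M) S) → T (deletion₀ (isBase M) S) → ⊥
contraction₀-deletion₀-disjoint M S B∪d B with exchange M (true ∷ S) (false ∷ S) B∪d B zero here (λ ())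
... | zero  , ()      , _
... | suc i , there i∈S , i∉S , _ = i∉S (there i∈S)

module Circuits where

  open import Data.Rational using (ℚ; 0ℚ; 1ℚ; _*_; _≟_; Positive; ≢-nonZero)
  open import Relation.Nullary using (yes; no)
  open import Data.Rational.Properties
    using (pos+pos⇒pos; pos*pos⇒pos; 1/pos⇒pos; positive⁻¹; <-irrefl; *-assoc; *-inverseˡ; *-identityʳ)

  argValue : {V : Set} {k : ℕ} → (V → ℚ) → (Fin k → ℚ) → Arg V k → ℚ
  argValue x val (inj₁ v) = x v
  argValue x val (inj₂ i) = val i

  Defined : {V : Set} {s : ℕ} → Circuit V s → Set
  Defined C = ∃₂ λ x v → evalCircuit C x ≡ just v

  Sound : {V : Set} {s : ℕ} → Circuit V s → ((V → ℚ) → ℚ) → Set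
  Sound C f = ∀ x v → evalCircuit C x ≡ just v → v ≡ f x

  -- w are the gate values after s further gates were placed on top of gates with values val.
  Extends : {k : ℕ} (s : ℕ) → (Fin (s ℕ.+ k) → ℚ) → (Fin k → ℚ) → Set
  Extends s w val = ∀ j → w (s ↑ʳ j) ≡ val j

  evalGates-▷⁺ : {V : Set} {k : ℕ} (x : V → ℚ) (G : Gates V k) (o : Op) (l r : Arg V k) {val : Fin k → ℚ} {u : ℚ} →
    evalGates x G ≡ just val → applyOp o (argValue x val l) (argValue x val r) ≡ just u →
    ∃ λ w → evalGates x (G ▷ (o , l , r)) ≡ just w × w zero ≡ u × Extends 1 w val
  evalGates-▷⁺ x G o (inj₁ v) (inj₁ v′) G⇓ o⇓ rewrite G⇓ | o⇓ = _ , refl , refl , λ _ → refl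
  evalGates-▷⁺ x G o (inj₁ v) (inj₂ j′) G⇓ o⇓ rewrite G⇓ | o⇓ = _ , refl , refl , λ _ → refl
  evalGates-▷⁺ x G o (inj₂ j) (inj₁ v′) G⇓ o⇓ rewrite G⇓ | o⇓ = _ , refl , refl , λ _ → refl
  evalGates-▷⁺ x G o (inj₂ j) (inj₂ j′) G⇓ o⇓ rewrite G⇓ | o⇓ = _ , refl , refl , λ _ → refl

  -- Splitting l and r lets the argument lookup inside evalGates reduce to argValue.
  evalGates-▷⁻ : {V : Set} {k : ℕ} (x : V → ℚ) (G : Gates V k) (o : Op) (l r : Arg V k) {w : Fin (suc k) → ℚ} →
    evalGates x (G ▷ (o , l , r)) ≡ just w →
    ∃ λ val → evalGates x G ≡ just val ×
      ∃ λ u → applyOp o (argValue x val l) (argValue x val r) ≡ just u × w zero ≡ u × Extends 1 w val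
  evalGates-▷⁻ x G o l r ⇓ with evalGates x G
  evalGates-▷⁻ x G o l r () | nothing
  evalGates-▷⁻ x G o (inj₁ v) (inj₁ v′) ⇓ | just val with applyOp o (x v) (x v′)
  ... | nothing = case ⇓ of λ ()
  ... | just u  = case ⇓ of λ { refl → val , refl , u , refl , refl , λ _ → refl }
  evalGates-▷⁻ x G o (inj₁ v) (inj₂ j′) ⇓ | just val with applyOp o (x v) (val j′) in o⇓
  ... | nothing = case ⇓ of λ ()
  ... | just u  = case ⇓ of λ { refl → val , refl , u , o⇓ , refl , λ _ → refl }
  evalGates-▷⁻ x G o (inj₂ j) (inj₁ v′) ⇓ | just val with applyOp o (val j) (x v′) in o⇓
  ... | nothing = case ⇓ of λ ()
  ... | just u  = case ⇓ of λ { refl → val , refl , u , o⇓ , refl , λ _ → refl }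
  evalGates-▷⁻ x G o (inj₂ j) (inj₂ j′) ⇓ | just val with applyOp o (val j) (val j′) in o⇓
  ... | nothing = case ⇓ of λ ()
  ... | just u  = case ⇓ of λ { refl → val , refl , u , o⇓ , refl , λ _ → refl }

  evalCircuit⁺ : {V : Set} {s : ℕ} (x : V → ℚ) (G : Gates V s) (o : Arg V s) {val : Fin s → ℚ} →
    evalGates x G ≡ just val → evalCircuit (circuit G o) x ≡ just (argValue x val o)
  evalCircuit⁺ x G (inj₁ v) G⇓ rewrite G⇓ = refl
  evalCircuit⁺ x G (inj₂ i) G⇓ rewrite G⇓ = refl

  evalCircuit⁻ : {V : Set} {s : ℕ} (x : V → ℚ) (G : Gates V s) (o : Arg V s) {v : ℚ} →
    evalCircuit (circuit G o) x ≡ just v → ∃ λ val → evalGates x G ≡ just val × v ≡ argValue x val o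
  evalCircuit⁻ x G o ⇓ with evalGates x G
  evalCircuit⁻ x G o        () | nothing
  evalCircuit⁻ x G (inj₁ v) refl | just val = val , refl , refl
  evalCircuit⁻ x G (inj₂ i) refl | just val = val , refl , refl

  applyOp-positive : (o : Op) {p q : ℚ} → Positive p → Positive q → ∃ λ u → applyOp o p q ≡ just u × Positive u
  applyOp-positive plus  {p} {q} p>0 q>0 = _ , refl , pos+pos⇒pos p {{p>0}} q {{q>0}}
  applyOp-positive times {p} {q} p>0 q>0 = _ , refl , pos*pos⇒pos p {{p>0}} q {{q>0}}
  applyOp-positive quot  {p} {q} p>0 q>0 with q ≟ 0ℚ
  ... | yes refl = ⊥-elim (<-irrefl refl (positive⁻¹ q {{q>0}}))
  ... | no  _    = _ , refl , pos*pos⇒pos p {{p>0}} _ {{1/pos⇒pos q {{q>0}}}}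

  evalGates-positive : {V : Set} {k : ℕ} (x : V → ℚ) → (∀ v → Positive (x v)) → (G : Gates V k) →
    ∃ λ val → evalGates x G ≡ just val × (∀ i → Positive (val i))
  evalGates-positive x x>0 [] = _ , refl , λ ()
  evalGates-positive x x>0 (G ▷ (o , l , r)) with evalGates-positive x x>0 G
  ... | val , G⇓ , val>0 with applyOp-positive o (argPositive l) (argPositive r)
    where
    argPositive : (a : Arg _ _) → Positive (argValue x val a)
    argPositive (inj₁ v) = x>0 v
    argPositive (inj₂ i) = val>0 i
  ... | u , o⇓ , u>0 with evalGates-▷⁺ x G o l r G⇓ o⇓
  ... | w , ⇓ , w₀≡u , w≡val = w , ⇓ , λ
    { zero    → subst Positive (sym w₀≡u) u>0
    ; (suc i) → subst Positive (sym (w≡val i)) (val>0 i) }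

  circuit-defined : {V : Set} {s : ℕ} (C : Circuit V s) → Defined C
  circuit-defined (circuit G o) with evalGates-positive (λ _ → 1ℚ) (λ _ → _) G
  ... | val , G⇓ , _ = (λ _ → 1ℚ) , _ , evalCircuit⁺ (λ _ → 1ℚ) G o G⇓

  divℚ-sound : (p q u : ℚ) → divℚ p q ≡ just u → u * q ≡ p
  divℚ-sound p q u ⇓ with q ≟ 0ℚ
  divℚ-sound p q u () | yes _
  divℚ-sound p q u refl | no q≢0 =
    trans (*-assoc p _ q) (trans (cong (p *_) (*-inverseˡ q {{≢-nonZero q≢0}})) (*-identityʳ p))

  weaken : {V : Set} {k : ℕ} (s : ℕ) → Arg V k → Arg V (s ℕ.+ k)
  weaken s (inj₁ v) = inj₁ v
  weaken s (inj₂ j) = inj₂ (s ↑ʳ j)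

  relabel : {V W : Set} {k : ℕ} (s : ℕ) → (W → Arg V k) → Arg W s → Arg V (s ℕ.+ k)
  relabel s σ (inj₁ v) = weaken s (σ v)
  relabel {k = k} s σ (inj₂ i) = inj₂ (i ↑ˡ k)

  append : {V W : Set} {k s : ℕ} → Gates W s → (W → Arg V k) → Gates V k → Gates V (s ℕ.+ k)
  append []                      σ G = G
  append (_▷_ {s} C (o , l , r)) σ G = append C σ G ▷ (o , relabel s σ l , relabel s σ r)

  argValue-weaken : {V : Set} {k : ℕ} (s : ℕ) (x : V → ℚ) {w : Fin (s ℕ.+ k) → ℚ} {val : Fin k → ℚ} →
    Extends s w val → (a : Arg V k) → argValue x w (weaken s a) ≡ argValue x val a
  argValue-weaken s x w≡val (inj₁ v) = refl
  argValue-weaken s x w≡val (inj₂ j) = w≡val j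

  argValue-relabel : {V W : Set} {k : ℕ} (s : ℕ) (σ : W → Arg V k) (x : V → ℚ)
    {w : Fin (s ℕ.+ k) → ℚ} {val : Fin k → ℚ} {valC : Fin s → ℚ} →
    (∀ i → w (i ↑ˡ k) ≡ valC i) → Extends s w val →
    (a : Arg W s) → argValue x w (relabel s σ a) ≡ argValue (argValue x val ∘ σ) valC a
  argValue-relabel s σ x w≡valC w≡val (inj₁ v) = argValue-weaken s x w≡val (σ v)
  argValue-relabel s σ x w≡valC w≡val (inj₂ i) = w≡valC i

  evalGates-append⁻ : {V W : Set} {k s : ℕ} (C : Gates W s) (σ : W → Arg V k) (G : Gates V k)
    (x : V → ℚ) {w : Fin (s ℕ.+ k) → ℚ} → evalGates x (append C σ G) ≡ just w →
    ∃₂ λ val valC → evalGates x G ≡ just val × evalGates (argValue x val ∘ σ) C ≡ just valC ×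
                    (∀ i → w (i ↑ˡ k) ≡ valC i) × Extends s w val
  evalGates-append⁻ [] σ G x ⇓ = _ , _ , ⇓ , refl , (λ ()) , λ _ → refl
  evalGates-append⁻ {k = k} (_▷_ {s} C (o , l , r)) σ G x ⇓
    with evalGates-▷⁻ x (append C σ G) o (relabel s σ l) (relabel s σ r) ⇓
  ... | w′ , ⇓′ , u , o⇓ , w₀≡u , w≡w′
    with evalGates-append⁻ C σ G x ⇓′
  ... | val , valC′ , G⇓ , C⇓ , w′≡valC′ , w′≡val
    with evalGates-▷⁺ (argValue x val ∘ σ) C o l r C⇓
           (subst₂ (λ p q → applyOp o p q ≡ just u) (relabeled l) (relabeled r) o⇓)
    where
    relabeled : ∀ a → argValue x w′ (relabel s σ a) ≡ argValue (argValue x val ∘ σ) valC′ a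
    relabeled = argValue-relabel s σ x w′≡valC′ w′≡val
  ... | valC , C▷⇓ , valC₀≡u , valC≡valC′ = val , valC , G⇓ , C▷⇓ ,
    (λ { zero    → trans w₀≡u (sym valC₀≡u)
       ; (suc i) → trans (w≡w′ (i ↑ˡ k)) (trans (w′≡valC′ i) (sym (valC≡valC′ i))) }) ,
    λ j → trans (w≡w′ (s ↑ʳ j)) (w′≡val j)

  append-sound : {V W : Set} {k s : ℕ} (C : Circuit W s) {f : (W → ℚ) → ℚ} → Sound C f →
    (σ : W → Arg V k) (G : Gates V k) (x : V → ℚ) {w : Fin (s ℕ.+ k) → ℚ} →
    evalGates x (append (gates C) σ G) ≡ just w →
    ∃ λ val → evalGates x G ≡ just val × Extends s w val ×
              argValue x w (relabel s σ (output C)) ≡ f (argValue x val ∘ σ)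
  append-sound {s = s} (circuit C o) C-sound σ G x ⇓ with evalGates-append⁻ C σ G x ⇓
  ... | val , valC , G⇓ , C⇓ , w≡valC , w≡val = val , G⇓ , w≡val ,
    trans (argValue-relabel s σ x w≡valC w≡val o)
          (C-sound (argValue x val ∘ σ) _ (evalCircuit⁺ (argValue x val ∘ σ) C o C⇓))

  module TwoSumCircuit {a b s₁ s∖ s/ : ℕ}
    (C₁ : Circuit (Fin (suc a)) s₁) (C∖ : Circuit (Fin b) s∖) (C/ : Circuit (Fin b) s/) where

    V : Set
    V = Fin (a ℕ.+ b)

    left : {k : ℕ} → Fin a → Arg V k
    left i = inj₁ (i ↑ˡ b)

    right : {k : ℕ} → Fin b → Arg V k
    right j = inj₁ (a ↑ʳ j)

    deletionGates : Gates V (s∖ ℕ.+ 0)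
    deletionGates = append (gates C∖) right []

    contractionGates : Gates V (s/ ℕ.+ (s∖ ℕ.+ 0))
    contractionGates = append (gates C/) right deletionGates

    deletionOut contractionOut : Arg V (s/ ℕ.+ (s∖ ℕ.+ 0))
    deletionOut    = weaken s/ (relabel s∖ right (output C∖))
    contractionOut = relabel s/ right (output C/)

    quotientGates : Gates V (suc (s/ ℕ.+ (s∖ ℕ.+ 0)))
    quotientGates = contractionGates ▷ (quot , deletionOut , contractionOut)

    substitution : Fin (suc a) → Arg V (suc (s/ ℕ.+ (s∖ ℕ.+ 0)))
    substitution zero    = inj₂ zero
    substitution (suc i) = left i

    substitutedGates : Gates V (s₁ ℕ.+ suc (s/ ℕ.+ (s∖ ℕ.+ 0)))
    substitutedGates = append (gates C₁) substitution quotientGates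

    substitutedOut denominatorOut : Arg V (s₁ ℕ.+ suc (s/ ℕ.+ (s∖ ℕ.+ 0)))
    substitutedOut = relabel s₁ substitution (output C₁)
    denominatorOut = weaken s₁ (weaken 1 contractionOut)

    twoSumCircuit : Circuit V (suc (s₁ ℕ.+ suc (s/ ℕ.+ (s∖ ℕ.+ 0))))
    twoSumCircuit = circuit (substitutedGates ▷ (times , substitutedOut , denominatorOut)) (inj₂ zero)

    module _ {f₁ : (Fin (suc a) → ℚ) → ℚ} {f∖ f/ : (Fin b → ℚ) → ℚ}
             (C₁-sound : Sound C₁ f₁) (C∖-sound : Sound C∖ f∖) (C/-sound : Sound C/ f/) where

      quotientGates-sound : (x : V → ℚ) {w : Fin (suc (s/ ℕ.+ (s∖ ℕ.+ 0))) → ℚ} →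
        evalGates x quotientGates ≡ just w → let x₂ = λ j → x (a ↑ʳ j) in
        w zero * f/ x₂ ≡ f∖ x₂ × argValue x w (weaken 1 contractionOut) ≡ f/ x₂
      quotientGates-sound x {w} ⇓
        with evalGates-▷⁻ x contractionGates quot deletionOut contractionOut ⇓
      ... | w₂ , ⇓₂ , u , ÷⇓ , w₀≡u , w≡w₂
        with append-sound C/ C/-sound right deletionGates x ⇓₂
      ... | w₁ , ⇓₁ , w₂≡w₁ , contraction≡
        with append-sound C∖ C∖-sound right [] x ⇓₁
      ... | _ , _ , _ , deletion≡ =
        subst₂ (λ q p → w zero * q ≡ p) contraction≡ deletion≡′ quotient ,
        trans (argValue-weaken 1 x w≡w₂ contractionOut) contraction≡
        where
        quotient : w zero * argValue x w₂ contractionOut ≡ argValue x w₂ deletionOut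
        quotient rewrite w₀≡u = divℚ-sound _ _ u ÷⇓

        deletion≡′ : argValue x w₂ deletionOut ≡ f∖ (λ j → x (a ↑ʳ j))
        deletion≡′ = trans (argValue-weaken s/ x w₂≡w₁ (relabel s∖ right (output C∖))) deletion≡

      twoSumCircuit-sound : (x : V → ℚ) (v : ℚ) → evalCircuit twoSumCircuit x ≡ just v →
        let x₂ = λ j → x (a ↑ʳ j) in
        ∃ λ y → tail y ≗ (λ i → x (i ↑ˡ b)) × y zero * f/ x₂ ≡ f∖ x₂ × v ≡ f₁ y * f/ x₂
      twoSumCircuit-sound x v ⇓
        with evalCircuit⁻ x (substitutedGates ▷ (times , substitutedOut , denominatorOut)) (inj₂ zero) ⇓
      ... | w₅ , ⇓₅ , v≡w₅₀
        with evalGates-▷⁻ x substitutedGates times substitutedOut denominatorOut ⇓₅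
      ... | w₄ , ⇓₄ , _ , refl , w₅₀≡ , _
        with append-sound C₁ C₁-sound substitution quotientGates x ⇓₄
      ... | w₃ , ⇓₃ , w₄≡w₃ , C₁≡
        with quotientGates-sound x ⇓₃
      ... | quotient , contraction≡ =
        argValue x w₃ ∘ substitution , (λ _ → refl) , quotient ,
        trans v≡w₅₀ (trans w₅₀≡ (cong₂ _*_ C₁≡ denominator≡))
        where
        denominator≡ : argValue x w₄ denominatorOut ≡ f/ (λ j → x (a ↑ʳ j))
        denominator≡ = trans (argValue-weaken s₁ x w₄≡w₃ (weaken 1 contractionOut)) contraction≡

open Polynomials using (basisPoly-twoSum-substitution)
open Circuits using (circuit-defined; module TwoSumCircuit)
open import Data.Nat using (_+_)
open import Data.Nat.Tactic.RingSolver using (solve-∀)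

proposition5 : {a b : ℕ} (M₁ : Matroid (suc a)) (M₂ : Matroid (suc b)) (s₁ s₂∖ s₂/ : ℕ) →
    RepresentableBySize s₁ (basisPoly (isBase M₁)) →
    RepresentableBySize s₂∖ (basisPoly (deletion₀ (isBase M₂))) →
    RepresentableBySize s₂/ (basisPoly (contraction₀ (isBase M₂))) →
    RepresentableBySize (s₁ + s₂∖ + s₂/ + 2) (basisPoly (twoSum (isBase M₁) (isBase M₂)))
proposition5 M₁ M₂ s₁ s₂∖ s₂/ (C₁ , _ , C₁-sound) (C∖ , _ , C∖-sound) (C/ , _ , C/-sound) =
  subst (λ s → RepresentableBySize s (basisPoly (twoSum (isBase M₁) (isBase M₂)))) (size s₁ s₂∖ s₂/)
        (twoSumCircuit , circuit-defined twoSumCircuit , sound)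
  where
  open TwoSumCircuit C₁ C∖ C/

  size : ∀ p q r → suc (p + suc (r + (q + 0))) ≡ p + q + r + 2
  size = solve-∀

  sound : ∀ x v → evalCircuit twoSumCircuit x ≡ just v → v ≡ basisPoly (twoSum (isBase M₁) (isBase M₂)) x
  sound x v ⇓ with twoSumCircuit-sound C₁-sound C∖-sound C/-sound x v ⇓
  ... | y , tail≗x₁ , quotient , v≡ =
    trans v≡ (basisPoly-twoSum-substitution (isBase M₁) (isBase M₂)
                (contraction₀-deletion₀-disjoint M₁) x y tail≗x₁ quotient)
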